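{- Let $P$ be a finite poset with $|P|\ge2$ and connected Hasse diagram that has a minimum element $\hat0$ or a maximum element $\hat1$. Then $U_P$ is Gorenstein if and only if $U_P$ is $\mathbb{Q}$-Gorenstein.
   Context: Identify $P$ with $[n]$; $N=\mathbb{Z}^n/\mathbb{Z}(1,\dots,1)$, $N_{\mathbb{R}}=N\otimes\mathbb{R}$, $M$ the dual lattice. The braid cone is $\sigma_P=\{x\in N_{\mathbb{R}}: x_i\le x_j\text{ whenever } i<_P j\}$ and $U_P$ is its affine toric variety. $U_P$ is $\mathbb{Q}$-Gorenstein if there exist $u\in M$ and a positive integer $r$ with $\langle u,v\rangle=r$ for every ray generator $v$ of $\sigma_P$; it is Gorenstein if this holds with $r=1$. -}

module Defs where

open import Level using (0ℓ)
open import Data.Nat using (ℕ; zero; suc; _≥_)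
open import Data.Fin using (Fin; zero; suc)
open import Data.Integer using (ℤ; _+_; _*_; _≤_; _<_; +_; 0ℤ; 1ℤ)
open import Data.Product using (Σ; ∃; _×_; _,_)
open import Data.Sum using (_⊎_)
open import Relation.Nullary using (¬_)
open import Relation.Binary using (Rel; IsPartialOrder)
open import Relation.Binary.PropositionalEquality using (_≡_; _≢_)
open import Relation.Binary.Construct.Closure.ReflexiveTransitive using (Star)
open import Relation.Binary.Construct.Closure.Symmetric using (SymClosure)

record FinPoset (n : ℕ) : Set₁ where
  field
    _≤P_      : Rel (Fin n) 0ℓ
    isPartialOrder : IsPartialOrder _≡_ _≤P_

  _<P_ : Rel (Fin n) 0ℓ
  i <P j = (i ≤P j) × (i ≢ j)

  _⋖_ : Rel (Fin n) 0ℓ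
  i ⋖ j = (i <P j) × ¬ (∃ λ k → (i <P k) × (k <P j))

  HasseConnected : Set
  HasseConnected = ∀ i j → Star (SymClosure _⋖_) i j

  HasMinimum : Set
  HasMinimum = ∃ λ z → ∀ x → z ≤P x

  HasMaximum : Set
  HasMaximum = ∃ λ z → ∀ x → x ≤P z

open FinPoset public

-- Integer vectors and the lattices N = ℤ^n / ℤ(1,…,1), M = its dual

Vecℤ : ℕ → Set
Vecℤ n = Fin n → ℤ

sumℤ : ∀ {n} → Vecℤ n → ℤ
sumℤ {zero}  f = 0ℤ
sumℤ {suc n} f = f zero + sumℤ (λ i → f (suc i))

⟪_,_⟫ : ∀ {n} → Vecℤ n → Vecℤ n → ℤ
⟪ u , v ⟫ = sumℤ (λ i → u i * v i)

-- M = { u ∈ ℤ^n : Σ u_i = 0 } (dual of N); pairing with N is ⟪_,_⟫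
InM : ∀ {n} → Vecℤ n → Set
InM u = sumℤ u ≡ 0ℤ

-- elements of N are represented by vectors in ℤ^n; equality in N
_≈N_ : ∀ {n} → Vecℤ n → Vecℤ n → Set
x ≈N y = ∃ λ (c : ℤ) → ∀ i → x i ≡ y i + c

_+v_ : ∀ {n} → Vecℤ n → Vecℤ n → Vecℤ n
(x +v y) i = x i + y i

_·v_ : ∀ {n} → ℤ → Vecℤ n → Vecℤ n
(k ·v x) i = k * x i

zeroV : ∀ {n} → Vecℤ n
zeroV i = 0ℤ

module _ {n : ℕ} (P : FinPoset n) where

  -- lattice point of N lying in σ_P (condition is invariant under ≈N)
  InCone : Vecℤ n → Set
  InCone x = ∀ i j → _<P_ P i j → x i ≤ x j

  -- v spans an extremal ray (1-dimensional face) of the rational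
  -- polyhedral cone σ_P: v ∈ σ_P, v ≠ 0 in N, and whenever lattice
  -- points a, b ∈ σ_P satisfy a + b = k v (k > 0), a lies on ℝ≥0 v.
  IsExtremal : Vecℤ n → Set
  IsExtremal v =
    InCone v × ¬ (v ≈N zeroV) ×
    (∀ a b (k : ℤ) → InCone a → InCone b → + 0 < k →
       (a +v b) ≈N (k ·v v) →
       ∃ λ (p : ℤ) → ∃ λ (q : ℤ) → + 0 ≤ p × + 0 < q × (q ·v a) ≈N (p ·v v))

  IsPrimitive : Vecℤ n → Set
  IsPrimitive v = ¬ (∃ λ (w : Vecℤ n) → ∃ λ (m : ℤ) → + 2 ≤ m × v ≈N (m ·v w))

  IsRayGenerator : Vecℤ n → Set
  IsRayGenerator v = IsExtremal v × IsPrimitive v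

  QGorenstein : Set
  QGorenstein = ∃ λ (u : Vecℤ n) → InM u × ∃ λ (r : ℕ) → (r ≥ 1) ×
    (∀ v → IsRayGenerator v → ⟪ u , v ⟫ ≡ + r)

  Gorenstein : Set
  Gorenstein = ∃ λ (u : Vecℤ n) → InM u ×
    (∀ v → IsRayGenerator v → ⟪ u , v ⟫ ≡ 1ℤ)

-- Suppose ⟨u, v⟩ = r for every ray generator v, with u ∈ M. It suffices to show
-- that r divides every coordinate of u, for then u / r is a Gorenstein witness.
-- If P has a minimum 0̂, then for every x ≠ 0̂ the indicator vector of the principal
-- up-set ↑x is a ray generator of σ_P, so r divides the sum of u over ↑x; the same
-- holds for x = 0̂ since u sums to zero. Peeling off x from ↑x by noetherian
-- induction on P then shows r ∣ u_x for all x. If P has a maximum 1̂, the same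
-- argument runs in the dual order, using the complements of principal down-sets.
module Submission where

open import Defs
open import Data.Nat using (ℕ; _≥_)
open import Data.Sum using (_⊎_)
open import Data.Product using (_×_)

open import Level using (0ℓ)
open import Data.Bool using (if_then_else_)
open import Data.Nat as ℕ using (zero; suc; s≤s)
import Data.Nat.Divisibility as ℕ
open import Data.Fin using (Fin; zero; suc)
open import Data.Fin.Properties using (_≟_; all?)
open import Data.Fin.Induction using (po-noetherian)
open import Data.Integer as ℤ using (ℤ; _+_; _*_; _-_; +_; 0ℤ; 1ℤ; _≤_; +≤+; +<+)
open import Data.Integer.Properties
  using (+-identityˡ; +-identityʳ; *-identityʳ; *-zeroʳ; *-comm; *-assoc; *-distribˡ-+; *-cancelˡ-≡;
         ≤-refl; ≤-antisym; ≮⇒≥; <-irrefl; +-mono-<-≤; i≤j⇒0≤j-i)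
open import Data.Integer.Divisibility.Signed
  using (_∣_; divides; quotient; _∣?_; ∣-reflexive; ∣⇒∣ᵤ; ∣m∣n⇒∣m+n; ∣m+n∣n⇒∣m)
open import Data.Integer.Tactic.RingSolver using (solve-∀)
open import Data.Product using (_,_; proj₁)
open import Data.Sum using (inj₁; inj₂; [_,_]′)
open import Data.Empty using (⊥-elim)
open import Data.Unit using (tt)
open import Function using (flip)
open import Induction.WellFounded using (module All)
open import Relation.Nullary using (¬_; Dec; yes; no; does; contradiction)
open import Relation.Nullary.Decidable using (¬?; decidable-stable; ¬¬-excluded-middle)
open import Relation.Binary using (Rel; Decidable; IsPartialOrder)
import Relation.Binary.Construct.Flip.EqAndOrd as Flip
import Relation.Binary.Construct.NonStrictToStrict as ToStrict
open import Relation.Binary.PropositionalEquality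

private
  variable
    n : ℕ

[_]·_ : {A : Set} → Dec A → ℤ → ℤ
[ d ]· z = if does d then z else 0ℤ

[]·-yes : {A : Set} (d : Dec A) {z : ℤ} → A → [ d ]· z ≡ z
[]·-yes (yes _) a = refl
[]·-yes (no ¬a) a = contradiction a ¬a

[]·-no : {A : Set} (d : Dec A) {z : ℤ} → ¬ A → [ d ]· z ≡ 0ℤ
[]·-no (yes a) ¬a = contradiction a ¬a
[]·-no (no _)  ¬a = refl

[]·-⊎ : {A B C : Set} (d : Dec A) (e : Dec B) (f : Dec C) →
        (A → B ⊎ C) → (B ⊎ C → A) → (B → ¬ C) →
        ∀ z → [ d ]· z ≡ [ e ]· z + [ f ]· z
[]·-⊎ (yes _) (yes b) (yes c) _  _    disj z = contradiction c (disj b)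
[]·-⊎ (yes _) (yes _) (no _)  _  _    disj z = sym (+-identityʳ z)
[]·-⊎ (yes _) (no _)  (yes _) _  _    disj z = sym (+-identityˡ z)
[]·-⊎ (yes a) (no ¬b) (no ¬c) to _    disj z = ⊥-elim ([ ¬b , ¬c ]′ (to a))
[]·-⊎ (no ¬a) (yes b) _       _  from disj z = contradiction (from (inj₁ b)) ¬a
[]·-⊎ (no ¬a) (no _)  (yes c) _  from disj z = contradiction (from (inj₂ c)) ¬a
[]·-⊎ (no _)  (no _)  (no _)  _  _    disj z = refl

sumℤ-cong : {f g : Vecℤ n} → (∀ i → f i ≡ g i) → sumℤ f ≡ sumℤ g
sumℤ-cong {zero}  f≗g = refl
sumℤ-cong {suc n} f≗g = cong₂ _+_ (f≗g zero) (sumℤ-cong (λ i → f≗g (suc i)))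

sumℤ-zero : sumℤ {n} (λ _ → 0ℤ) ≡ 0ℤ
sumℤ-zero {zero}  = refl
sumℤ-zero {suc n} = trans (+-identityˡ _) (sumℤ-zero {n})

sumℤ-+ : (f g : Vecℤ n) → sumℤ (f +v g) ≡ sumℤ f + sumℤ g
sumℤ-+ {zero}  f g = refl
sumℤ-+ {suc n} f g = begin
  f zero + g zero + sumℤ (f′ +v g′)      ≡⟨ cong (_+_ (f zero + g zero)) (sumℤ-+ f′ g′) ⟩
  f zero + g zero + (sumℤ f′ + sumℤ g′)  ≡⟨ interchange (f zero) (g zero) (sumℤ f′) (sumℤ g′) ⟩
  f zero + sumℤ f′ + (g zero + sumℤ g′)  ∎
  where
  open ≡-Reasoning
  f′ g′ : Vecℤ _
  f′ i = f (suc i)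
  g′ i = g (suc i)
  interchange : ∀ a b c d → a + b + (c + d) ≡ a + c + (b + d)
  interchange = solve-∀

sumℤ-*ˡ : (k : ℤ) (f : Vecℤ n) → sumℤ (k ·v f) ≡ k * sumℤ f
sumℤ-*ˡ {zero}  k f = sym (*-zeroʳ k)
sumℤ-*ˡ {suc n} k f = trans (cong (_+_ (k * f zero)) (sumℤ-*ˡ k (λ i → f (suc i))))
                            (sym (*-distribˡ-+ k (f zero) _))

∣0 : {k : ℤ} → k ∣ 0ℤ
∣0 = divides 0ℤ refl

∣-sumℤ : {k : ℤ} {f : Vecℤ n} → (∀ i → k ∣ f i) → k ∣ sumℤ f
∣-sumℤ {zero}  k∣f = ∣0
∣-sumℤ {suc n} k∣f = ∣m∣n⇒∣m+n (k∣f zero) (∣-sumℤ (λ i → k∣f (suc i)))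

sumOver : {A : Fin n → Set} → (∀ i → Dec (A i)) → Vecℤ n → ℤ
sumOver A? u = sumℤ (λ j → [ A? j ]· u j)

indicator : {A : Fin n → Set} → (∀ i → Dec (A i)) → Vecℤ n
indicator A? i = [ A? i ]· 1ℤ

⟪⟫-indicator : {A : Fin n → Set} (A? : ∀ i → Dec (A i)) (u : Vecℤ n) →
               ⟪ u , indicator A? ⟫ ≡ sumOver A? u
⟪⟫-indicator A? u = sumℤ-cong u*𝟙≡[]·u
  where
  u*𝟙≡[]·u : ∀ i → u i * indicator A? i ≡ [ A? i ]· u i
  u*𝟙≡[]·u i with A? i
  ... | yes _ = *-identityʳ (u i)
  ... | no _  = *-zeroʳ (u i)

sumOver-full : {A : Fin n → Set} (A? : ∀ i → Dec (A i)) (u : Vecℤ n) →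
               (∀ i → A i) → sumOver A? u ≡ sumℤ u
sumOver-full A? u all = sumℤ-cong (λ i → []·-yes (A? i) (all i))

sumOver-empty : {A : Fin n → Set} (A? : ∀ i → Dec (A i)) (u : Vecℤ n) →
                (∀ i → ¬ A i) → sumOver A? u ≡ 0ℤ
sumOver-empty {n} A? u none = trans (sumℤ-cong (λ i → []·-no (A? i) (none i))) (sumℤ-zero {n})

sumOver-⊎ : {A B C : Fin n → Set}
            (A? : ∀ i → Dec (A i)) (B? : ∀ i → Dec (B i)) (C? : ∀ i → Dec (C i)) →
            (∀ {i} → A i → B i ⊎ C i) → (∀ {i} → B i ⊎ C i → A i) → (∀ {i} → B i → ¬ C i) →
            ∀ u → sumOver A? u ≡ sumOver B? u + sumOver C? u
sumOver-⊎ A? B? C? to from disj u =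
  trans (sumℤ-cong (λ i → []·-⊎ (A? i) (B? i) (C? i) to from disj (u i)))
        (sumℤ-+ (λ i → [ B? i ]· u i) (λ i → [ C? i ]· u i))

sumOver-complement : {A : Fin n → Set} (A? : ∀ i → Dec (A i)) (u : Vecℤ n) →
                     sumOver A? u + sumOver (λ i → ¬? (A? i)) u ≡ sumℤ u
sumOver-complement {A = A} A? u =
  sym (sumOver-⊎ (λ _ → yes tt) A? (λ i → ¬? (A? i)) (λ _ → decide _) (λ _ → tt) (λ a ¬a → ¬a a) u)
  where
  decide : ∀ i → A i ⊎ ¬ A i
  decide i with A? i
  ... | yes a = inj₁ a
  ... | no ¬a = inj₂ ¬a

sumOver-≟ : (u : Vecℤ n) (x : Fin n) → sumOver (x ≟_) u ≡ u x
sumOver-≟ {suc n} u zero    = trans (cong (_+_ (u zero)) (sumℤ-zero {n})) (+-identityʳ (u zero))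
sumOver-≟ {suc n} u (suc x) = trans (+-identityˡ _) (sumOver-≟ (λ i → u (suc i)) x)

∣-sumOver : {A : Fin n → Set} (A? : ∀ i → Dec (A i)) {k : ℤ} {u : Vecℤ n} →
            (∀ i → A i → k ∣ u i) → k ∣ sumOver A? u
∣-sumOver A? {k} {u} k∣u = ∣-sumℤ k∣[]·u
  where
  k∣[]·u : ∀ i → k ∣ [ A? i ]· u i
  k∣[]·u i with A? i
  ... | yes a = k∣u i a
  ... | no _  = ∣0

module _ {_⊑_ : Rel (Fin n) 0ℓ} (isPO : IsPartialOrder _≡_ _⊑_) (_⊑?_ : Decidable _⊑_) where

  open ToStrict _≡_ _⊑_ using (_<_; <-decidable)

  ∣-upSetSums⇒∣ : {k : ℤ} {u : Vecℤ n} → (∀ x → k ∣ sumOver (x ⊑?_) u) → ∀ x → k ∣ u x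
  ∣-upSetSums⇒∣ {k} {u} k∣upSum = All.wfRec (po-noetherian isPO) 0ℓ (λ x → k ∣ u x) step
    where
    _<?_ : Decidable _<_
    _<?_ = <-decidable _≟_ _⊑?_
    split : ∀ x → sumOver (x ⊑?_) u ≡ u x + sumOver (x <?_) u
    split x = trans (sumOver-⊎ (x ⊑?_) (x ≟_) (x <?_) to from disjoint u)
                    (cong (_+ sumOver (x <?_) u) (sumOver-≟ u x))
      where
      to : ∀ {j} → x ⊑ j → x ≡ j ⊎ x < j
      to {j} x⊑j with x ≟ j
      ... | yes x≡j = inj₁ x≡j
      ... | no x≢j  = inj₂ (x⊑j , x≢j)
      from : ∀ {j} → x ≡ j ⊎ x < j → x ⊑ j
      from (inj₁ refl)      = IsPartialOrder.refl isPO
      from (inj₂ (x⊑j , _)) = x⊑j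
      disjoint : ∀ {j} → x ≡ j → ¬ x < j
      disjoint x≡j (_ , x≢j) = x≢j x≡j
    step : ∀ x → (∀ {y} → x < y → k ∣ u y) → k ∣ u x
    step x ih = ∣m+n∣n⇒∣m (subst (k ∣_) (split x) (k∣upSum x)) (∣-sumOver (x <?_) (λ _ → ih))

¬¬-Π-Fin : {Q : Fin n → Set} → (∀ i → ¬ ¬ Q i) → ¬ ¬ (∀ i → Q i)
¬¬-Π-Fin {zero}  ¬¬Q ¬∀Q = ¬∀Q (λ ())
¬¬-Π-Fin {suc n} ¬¬Q ¬∀Q = ¬¬Q zero λ Q₀ → ¬¬-Π-Fin (λ i → ¬¬Q (suc i)) λ Qₛ →
  ¬∀Q λ { zero → Q₀ ; (suc i) → Qₛ i }

≤-+-≡⇒≡ˡ : ∀ {i j k l} → i ≤ j → k ≤ l → i + k ≡ j + l → i ≡ j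
≤-+-≡⇒≡ˡ i≤j k≤l eq = ≤-antisym i≤j (≮⇒≥ λ j<i → <-irrefl eq (+-mono-<-≤ j<i k≤l))

module _ (P : FinPoset n) where

  open FinPoset P using () renaming (_≤P_ to _⊑_; _<P_ to _⊏_; isPartialOrder to isPO)
  open IsPartialOrder isPO using () renaming (refl to ⊑-refl; trans to ⊑-trans; antisym to ⊑-antisym)

  Comparable : Fin n → Fin n → Set
  Comparable i j = i ≡ j ⊎ j ⊏ i ⊎ i ⊏ j

  ⊑⇒Comparable : ∀ {i j} → i ⊑ j → Comparable i j
  ⊑⇒Comparable {i} {j} i⊑j with i ≟ j
  ... | yes i≡j = inj₁ i≡j
  ... | no i≢j  = inj₂ (inj₂ (i⊑j , i≢j))

  ⊒⇒Comparable : ∀ {i j} → j ⊑ i → Comparable i j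
  ⊒⇒Comparable {i} {j} j⊑i with j ≟ i
  ... | yes j≡i = inj₁ (sym j≡i)
  ... | no j≢i  = inj₂ (inj₁ (j⊑i , j≢i))

  -- Every element of A is comparable with α and every other element with β, so the
  -- cone inequalities force any decomposition of k·𝟙_A inside σ_P to be constant on
  -- A and on its complement.
  module _ {A : Fin n → Set} (A? : ∀ i → Dec (A i)) (A-upClosed : ∀ {i j} → i ⊏ j → A i → A j)
           {α β : Fin n} (α∈A : A α) (β∉A : ¬ A β) (β⊏α : β ⊏ α)
           (comparable-α : ∀ i → A i → Comparable i α)
           (comparable-β : ∀ i → ¬ A i → Comparable i β) where

    private
      v : Vecℤ n
      v = indicator A?

    v-∈ : ∀ {i} → A i → v i ≡ 1ℤ
    v-∈ {i} = []·-yes (A? i)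

    v-∉ : ∀ {i} → ¬ A i → v i ≡ 0ℤ
    v-∉ {i} = []·-no (A? i)

    indicator-inCone : InCone P v
    indicator-inCone i j i⊏j with A? i | A? j
    ... | yes _ | yes _  = ≤-refl
    ... | no _  | yes _  = +≤+ ℕ.z≤n
    ... | no _  | no _   = ≤-refl
    ... | yes a | no ¬aj = contradiction (A-upClosed i⊏j a) ¬aj

    indicator-≉0 : ¬ (v ≈N zeroV)
    indicator-≉0 (c , v≡c) with trans (sym (v-∈ α∈A)) (trans (v≡c α) (trans (sym (v≡c β)) (v-∉ β∉A)))
    ... | ()

    module _ (a b : Vecℤ n) (k c : ℤ) (a∈σ : InCone P a) (b∈σ : InCone P b)
             (a+b≡kv : ∀ i → a i + b i ≡ k * v i + c) where

      sums-≡ : ∀ {i j} → v i ≡ v j → a i + b i ≡ a j + b j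
      sums-≡ {i} {j} e = trans (a+b≡kv i) (trans (cong (λ t → k * t + c) e) (sym (a+b≡kv j)))

      ≡-on-comparable : ∀ {i j} → Comparable i j → v i ≡ v j → a i ≡ a j
      ≡-on-comparable (inj₁ refl)       _ = refl
      ≡-on-comparable (inj₂ (inj₁ j⊏i)) e = sym (≤-+-≡⇒≡ˡ (a∈σ _ _ j⊏i) (b∈σ _ _ j⊏i) (sums-≡ (sym e)))
      ≡-on-comparable (inj₂ (inj₂ i⊏j)) e = ≤-+-≡⇒≡ˡ (a∈σ _ _ i⊏j) (b∈σ _ _ i⊏j) (sums-≡ e)

      constant-on-A : ∀ {i} → A i → a i ≡ a α
      constant-on-A ai = ≡-on-comparable (comparable-α _ ai) (trans (v-∈ ai) (sym (v-∈ α∈A)))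

      constant-off-A : ∀ {i} → ¬ A i → a i ≡ a β
      constant-off-A ¬ai = ≡-on-comparable (comparable-β _ ¬ai) (trans (v-∉ ¬ai) (sym (v-∉ β∉A)))

      line-through-1 : ∀ x y → 1ℤ * x ≡ (x - y) * 1ℤ + y
      line-through-1 = solve-∀

      line-through-0 : ∀ p y → 1ℤ * y ≡ p * 0ℤ + y
      line-through-0 = solve-∀

      decomposition : ∀ i → 1ℤ * a i ≡ (a α - a β) * v i + a β
      decomposition i with A? i
      ... | yes ai = trans (cong (1ℤ *_) (constant-on-A ai)) (line-through-1 (a α) (a β))
      ... | no ¬ai = trans (cong (1ℤ *_) (constant-off-A ¬ai)) (line-through-0 (a α - a β) (a β))

    indicator-isExtremal : IsExtremal P v
    indicator-isExtremal = indicator-inCone , indicator-≉0 , λ a b k a∈σ b∈σ _ (c , a+b≡kv) →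
      a α - a β , 1ℤ , i≤j⇒0≤j-i (a∈σ β α β⊏α) , +<+ (s≤s ℕ.z≤n) ,
      (a β , decomposition a b k c a∈σ b∈σ a+b≡kv)

    indicator-isPrimitive : IsPrimitive P v
    indicator-isPrimitive (w , m , 2≤m , c , v≡mw) = ≥2-∤1 2≤m (∣⇒∣ᵤ m∣1)
      where
      cancel : ∀ m x y c → (m * x + c) - (m * y + c) ≡ (x - y) * m
      cancel = solve-∀
      -- 1 = v α - v β = m (w α - w β)
      m∣1 : m ∣ 1ℤ
      m∣1 = divides (w α - w β)
        (trans (cong₂ _-_ (trans (sym (v-∈ α∈A)) (v≡mw α)) (trans (sym (v-∉ β∉A)) (v≡mw β)))
               (cancel m (w α) (w β) c))
      ≥2-∤1 : ∀ {m} → + 2 ≤ m → ¬ (ℤ.∣ m ∣ ℕ.∣ 1)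
      ≥2-∤1 {+ k} (+≤+ 2≤k) k∣1 with ℕ.∣1⇒≡1 k∣1
      ≥2-∤1 {+ .1} (+≤+ (s≤s ())) _ | refl

    indicator-isRayGenerator : IsRayGenerator P v
    indicator-isRayGenerator = indicator-isExtremal , indicator-isPrimitive

  module _ (_⊑?_ : Decidable _⊑_) {u : Vecℤ n} (u∈M : InM u) {k : ℤ}
           (⟪u,ray⟫≡k : ∀ v → IsRayGenerator P v → ⟪ u , v ⟫ ≡ k) where

    indicatorRay⇒∣sumOver : {A : Fin n → Set} (A? : ∀ i → Dec (A i)) →
                            IsRayGenerator P (indicator A?) → k ∣ sumOver A? u
    indicatorRay⇒∣sumOver A? isRay = ∣-reflexive (trans (sym (⟪u,ray⟫≡k _ isRay)) (⟪⟫-indicator A? u))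

    HasMinimum⇒∣u : HasMinimum P → ∀ i → k ∣ u i
    HasMinimum⇒∣u (z , z⊑) = ∣-upSetSums⇒∣ isPO _⊑?_ k∣upSum
      where
      k∣upSum : ∀ x → k ∣ sumOver (x ⊑?_) u
      k∣upSum x with x ≟ z
      ... | yes refl = subst (k ∣_) (sym (trans (sumOver-full (x ⊑?_) u z⊑) u∈M)) ∣0
      ... | no x≢z = indicatorRay⇒∣sumOver (x ⊑?_)
        (indicator-isRayGenerator (x ⊑?_) (λ i⊏j x⊑i → ⊑-trans x⊑i (proj₁ i⊏j))
          ⊑-refl (λ x⊑z → x≢z (⊑-antisym x⊑z (z⊑ x))) (z⊑ x , λ z≡x → x≢z (sym z≡x))
          (λ i x⊑i → ⊒⇒Comparable x⊑i) (λ i _ → ⊒⇒Comparable (z⊑ i)))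

    HasMaximum⇒∣u : HasMaximum P → ∀ i → k ∣ u i
    HasMaximum⇒∣u (t , ⊑t) = ∣-upSetSums⇒∣ (Flip.isPartialOrder isPO) (flip _⊑?_) k∣downSum
      where
      k∣downSum : ∀ x → k ∣ sumOver (_⊑? x) u
      k∣downSum x = ∣m+n∣n⇒∣m (subst (k ∣_) (sym (trans (sumOver-complement (_⊑? x) u) u∈M)) ∣0)
                              k∣complement
        where
        k∣complement : k ∣ sumOver (λ i → ¬? (i ⊑? x)) u
        k∣complement with x ≟ t
        ... | yes refl =
          subst (k ∣_) (sym (sumOver-empty (λ i → ¬? (i ⊑? x)) u (λ i i⋢t → i⋢t (⊑t i)))) ∣0
        ... | no x≢t = indicatorRay⇒∣sumOver (λ i → ¬? (i ⊑? x))
          (indicator-isRayGenerator (λ i → ¬? (i ⊑? x))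
            (λ i⊏j i⋢x j⊑x → i⋢x (⊑-trans (proj₁ i⊏j) j⊑x))
            (λ t⊑x → x≢t (⊑-antisym (⊑t x) t⊑x)) (λ x⋢x → x⋢x ⊑-refl) (⊑t x , x≢t)
            (λ i _ → ⊑⇒Comparable (⊑t i)) (λ i ¬i⋢x → ⊑⇒Comparable (decidable-stable (i ⊑? x) ¬i⋢x)))

  Gorenstein⇒QGorenstein : Gorenstein P → QGorenstein P
  Gorenstein⇒QGorenstein (u , u∈M , ⟪u,ray⟫≡1) = u , u∈M , 1 , s≤s ℕ.z≤n , ⟪u,ray⟫≡1

  -- ⊑ need not be decidable, but the conclusion is (all? over Fin), so a double-negated
  -- decision procedure for ⊑ suffices.
  ¬¬-⊑-decidable : ¬ ¬ Decidable _⊑_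
  ¬¬-⊑-decidable = ¬¬-Π-Fin (λ i → ¬¬-Π-Fin (λ j → ¬¬-excluded-middle))

  QGorenstein⇒Gorenstein : HasMinimum P ⊎ HasMaximum P → QGorenstein P → Gorenstein P
  QGorenstein⇒Gorenstein extremum (u , u∈M , suc r , _ , ⟪u,ray⟫≡r) =
    w , *-cancelˡ-≡ R _ _ R*Σw≡R*0 , λ v isRay → *-cancelˡ-≡ R _ _ (R*⟪w,v⟫≡R*1 v isRay)
    where
    R : ℤ
    R = + suc r
    R∣u : ∀ i → R ∣ u i
    R∣u = decidable-stable (all? (λ i → R ∣? u i)) λ R∤u → ¬¬-⊑-decidable λ _⊑?_ →
      R∤u ([ HasMinimum⇒∣u _⊑?_ u∈M ⟪u,ray⟫≡r , HasMaximum⇒∣u _⊑?_ u∈M ⟪u,ray⟫≡r ]′ extremum)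
    w : Vecℤ n
    w i = quotient (R∣u i)
    u≡Rw : ∀ i → u i ≡ R * w i
    u≡Rw i = trans (_∣_.equality (R∣u i)) (*-comm (w i) R)
    R*Σw≡R*0 : R * sumℤ w ≡ R * 0ℤ
    R*Σw≡R*0 = begin
      R * sumℤ w     ≡⟨ sumℤ-*ˡ R w ⟨
      sumℤ (R ·v w)  ≡⟨ sumℤ-cong u≡Rw ⟨
      sumℤ u         ≡⟨ u∈M ⟩
      0ℤ             ≡⟨ *-zeroʳ R ⟨
      R * 0ℤ         ∎
      where open ≡-Reasoning
    R*⟪w,v⟫≡R*1 : ∀ v → IsRayGenerator P v → R * ⟪ w , v ⟫ ≡ R * 1ℤ
    R*⟪w,v⟫≡R*1 v isRay = begin
      R * ⟪ w , v ⟫                  ≡⟨ sumℤ-*ˡ R (λ i → w i * v i) ⟨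
      sumℤ (λ i → R * (w i * v i))  ≡⟨ sumℤ-cong (λ i → *-assoc R (w i) (v i)) ⟨
      sumℤ (λ i → R * w i * v i)    ≡⟨ sumℤ-cong (λ i → cong (_* v i) (u≡Rw i)) ⟨
      ⟪ u , v ⟫                      ≡⟨ ⟪u,ray⟫≡r v isRay ⟩
      R                              ≡⟨ *-identityʳ R ⟨
      R * 1ℤ                         ∎
      where open ≡-Reasoning

theorem5p2 : (n : ℕ) → n ≥ 2 → (P : FinPoset n) → HasseConnected P →
    (HasMinimum P ⊎ HasMaximum P) →
    (Gorenstein P → QGorenstein P) × (QGorenstein P → Gorenstein P)
theorem5p2 n _ P _ extremum = Gorenstein⇒QGorenstein P , QGorenstein⇒Gorenstein P extremum
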